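{- Let $r\ge 2$ be an integer. Every graph $G$ with $m$ edges contains a subgraph with at least $\frac14 m^{r/(r+1)}$ edges which contains no copy of $K_{r,r}$.
   Context: $K_{r,r}$ is the complete bipartite graph with both parts of order $r$. -}

module Defs where

open import Data.Nat using (ℕ; _<ᵇ_)
open import Data.Bool using (Bool; true; false; _∧_)
open import Data.Fin using (Fin; toℕ)
open import Data.List using (List; length; filterᵇ; cartesianProduct; allFin)
open import Data.Product using (Σ; _×_; _,_; proj₁; proj₂)
open import Data.Sum using (_⊎_; inj₁; inj₂)
open import Relation.Binary.PropositionalEquality using (_≡_)
open import Function.Definitions using (Injective)

record Graph (n : ℕ) : Set where
  field
    adj    : Fin n → Fin n → Bool
    sym    : ∀ i j → adj i j ≡ adj j i
    irrefl : ∀ i → adj i i ≡ false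
open Graph public

edgeCount : ∀ {n} → Graph n → ℕ
edgeCount {n} G =
  length (filterᵇ (λ p → (toℕ (proj₁ p) <ᵇ toℕ (proj₂ p)) ∧ adj G (proj₁ p) (proj₂ p))
                  (cartesianProduct (allFin n) (allFin n)))

-- H is a subgraph of G (on the same vertex set; isolated vertices are irrelevant).
_⊆G_ : ∀ {n} → Graph n → Graph n → Set
H ⊆G G = ∀ i j → adj H i j ≡ true → adj G i j ≡ true

ContainsK : ∀ {n} → ℕ → Graph n → Set
ContainsK {n} r H =
  Σ (Fin r ⊎ Fin r → Fin n) λ f →
    Injective _≡_ _≡_ f × (∀ i j → adj H (f (inj₁ i)) (f (inj₂ j)) ≡ true)

-- Keep each edge of G independently with probability p = a / b, then delete one edge from
-- every copy of K_{r,r} that survives.  A copy is determined by r of its edges a_i b_i, each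
-- taken with an orientation, so G has at most (2m)^r copies, and each survives with
-- probability p^(r²); hence some choice leaves at least p m − (2m)^r p^(r²) edges and no copy.
-- Expectations are computed exactly, as weighted sums over all subsets of the edges, and some
-- subset is at least as good as the average.  For
-- p^(r+1) ≈ 1 / (2^(r+2) m) the copies cost at most a quarter of p m, and the (3/4) p m edges
-- left are at least (1/4) m^(r/(r+1)).  Since p must be rational, a = 2(r+1) and b is picked
-- with b^(r+1) within a factor 3/2 of 2^(r+2) m a^(r+1), which is precise enough.

module Submission where

open import Defs renaming (sym to adj-sym; irrefl to adj-irrefl)
open import Data.Bool using (Bool; true; false; _∧_; T; T?; if_then_else_)
open import Data.Bool.Properties using (T-≡; T-∧)
open import Data.Fin using (Fin; zero; suc; toℕ; punchIn; punchOut)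
open import Data.Fin.Properties
  using (_≟_; any?; toℕ-injective; punchOut-injective; punchIn-injective; punchIn-punchOut; punchInᵢ≢i)
open import Data.Fin.Subset using (Subset; inside; outside; ⊥; _⊆_; _⊈_; _─_; ∣_∣) renaming (_∈_ to _∈ₛ_)
open import Data.Fin.Subset.Properties using (_⊆?_; drop-there; drop-∷-⊆; ∣p∣≤∣x∷p∣; p─⊥≡p; p─q⊆p; ⊆-trans)
open import Data.List
  using (List; []; _∷_; _++_; length; map; filter; filterᵇ; cartesianProduct; cartesianProductWith; allFin; lookup)
open import Data.List.Properties using (length-++; length-map; length-tabulate; length-filter; filter-all)
open import Data.List.Membership.Propositional using (_∈_; _∉_)
open import Data.List.Membership.Propositional.Properties
  using (∈-filter⁺; ∈-filter⁻; ∈-map⁺; ∈-map⁻; ∈-++⁺ˡ; ∈-++⁺ʳ; ∈-cartesianProduct⁺; ∈-cartesianProductWith⁺; ∈-lookup; ∈-allFin)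
open import Data.List.Relation.Unary.All as All using (All; []; _∷_)
open import Data.List.Relation.Unary.AllPairs using (_∷_)
open import Data.List.Relation.Unary.Any as Any using (here; there; index)
open import Data.List.Relation.Unary.Any.Properties using (lookup-index)
open import Data.List.Relation.Unary.Unique.DecPropositional using (unique?)
open import Data.List.Relation.Unary.Unique.Propositional using (Unique)
open import Data.List.Relation.Unary.Unique.Propositional.Properties as Unique using (cartesianProduct⁺; allFin⁺)
import Data.List.Relation.Binary.Sublist.Propositional as Sublist
open Sublist using ([]; _∷_; _∷ʳ_)
open import Data.List.Relation.Binary.Sublist.Propositional.Properties using (filter-⊆; filter⁺; length-mono-≤)
open import Data.Nat using (ℕ; zero; suc; _+_; _*_; _^_; _∸_; _≤_; _<_; _<ᵇ_; z≤n; s≤s; NonZero; >-nonZero; _≤?_)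
open import Data.Nat.ListAction using (sum)
open import Data.Nat.Properties hiding (_≟_)
open import Algebra.Properties.CommutativeSemigroup *-commutativeSemigroup using (x∙yz≈y∙xz)
open import Data.Nat.Tactic.RingSolver using (solve-∀)
open import Data.Product using (Σ; ∃; ∃₂; _×_; _,_; proj₁; proj₂; swap)
open import Data.Product.Properties using (≡-dec; ,-injective)
open import Data.Sum using (_⊎_; inj₁; inj₂)
open import Data.Sum.Properties using (inj₁-injective; inj₂-injective)
open import Data.Vec as Vec using (Vec; []; _∷_; here; there)
open import Data.Vec.Properties using (lookup∘tabulate; lookup⇒[]=; []=⇒lookup)
open import Function using (id; _∘_; const; Equivalence; case_of_)
open import Function.Definitions using (Injective)
open import Relation.Nullary using (Dec; yes; no; does; ¬_; contradiction)
open import Relation.Nullary.Decidable using (dec-true; dec-false; _×-dec_)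
open import Relation.Binary.PropositionalEquality

⟦_⊆_⟧ : ∀ {m} → Subset m → Subset m → ℕ
⟦ T ⊆ s ⟧ = if does (T ⊆? s) then 1 else 0

⟦⊆⟧≤1 : ∀ {m} (T s : Subset m) → ⟦ T ⊆ s ⟧ ≤ 1
⟦⊆⟧≤1 T s with does (T ⊆? s)
... | true  = ≤-refl
... | false = z≤n

contained : ∀ {m} → List (Subset m) → Subset m → ℕ
contained Ts s = sum (map (λ T → ⟦ T ⊆ s ⟧) Ts)

first : ∀ {m} → Subset m → Subset m
first []            = []
first (inside  ∷ p) = inside ∷ ⊥
first (outside ∷ p) = outside ∷ first p

∣p∣≤1+∣p─first[q]∣ : ∀ {m} (p q : Subset m) → ∣ p ∣ ≤ suc ∣ p ─ first q ∣
∣p∣≤1+∣p─first[q]∣ []            []            = z≤n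
∣p∣≤1+∣p─first[q]∣ (x ∷ p)       (inside ∷ q)   =
  ≤-trans (∣x∷p∣≤1+∣p∣ x) (≤-reflexive (cong (suc ∘ ∣_∣) (sym (p─⊥≡p p))))
  where
  ∣x∷p∣≤1+∣p∣ : ∀ x → ∣ x ∷ p ∣ ≤ suc ∣ p ∣
  ∣x∷p∣≤1+∣p∣ inside  = ≤-refl
  ∣x∷p∣≤1+∣p∣ outside = n≤1+n ∣ p ∣
∣p∣≤1+∣p─first[q]∣ (inside ∷ p)  (outside ∷ q) = s≤s (∣p∣≤1+∣p─first[q]∣ p q)
∣p∣≤1+∣p─first[q]∣ (outside ∷ p) (outside ∷ q) = ∣p∣≤1+∣p─first[q]∣ p q

⊈-─first : ∀ {m} (T p : Subset m) → 1 ≤ ∣ T ∣ → T ⊈ p ─ first T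
⊈-─first (inside  ∷ T) (x ∷ p) _     T⊆ with T⊆ here
... | ()
⊈-─first (outside ∷ T) (x ∷ p) 1≤∣T∣ T⊆ = ⊈-─first T p 1≤∣T∣ (drop-∷-⊆ T⊆)

spoil : ∀ {m} → Subset m → Subset m → Subset m
spoil T s = if does (T ⊆? s) then s ─ first T else s

spoilAll : ∀ {m} → List (Subset m) → Subset m → Subset m
spoilAll []       s = s
spoilAll (T ∷ Ts) s = spoilAll Ts (spoil T s)

spoil-⊆ : ∀ {m} (T s : Subset m) → spoil T s ⊆ s
spoil-⊆ T s with does (T ⊆? s)
... | true  = p─q⊆p s (first T)
... | false = λ x∈s → x∈s

spoilAll-⊆ : ∀ {m} (Ts : List (Subset m)) s → spoilAll Ts s ⊆ s
spoilAll-⊆ []       s = λ x∈s → x∈s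
spoilAll-⊆ (T ∷ Ts) s = ⊆-trans (spoilAll-⊆ Ts (spoil T s)) (spoil-⊆ T s)

spoil-∣∣ : ∀ {m} (T s : Subset m) → ∣ s ∣ ≤ ⟦ T ⊆ s ⟧ + ∣ spoil T s ∣
spoil-∣∣ T s with does (T ⊆? s)
... | true  = ∣p∣≤1+∣p─first[q]∣ s T
... | false = ≤-refl

spoil-⊈ : ∀ {m} (T s : Subset m) → 1 ≤ ∣ T ∣ → T ⊈ spoil T s
spoil-⊈ T s 1≤∣T∣ with T ⊆? s
... | yes _   = ⊈-─first T s 1≤∣T∣
... | no  T⊈s = T⊈s

⟦⊆⟧-mono : ∀ {m} (T : Subset m) {s s′} → s ⊆ s′ → ⟦ T ⊆ s ⟧ ≤ ⟦ T ⊆ s′ ⟧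
⟦⊆⟧-mono T {s} {s′} s⊆s′ with T ⊆? s | T ⊆? s′
... | yes _   | yes _    = ≤-refl
... | yes T⊆s | no  T⊈s′ = contradiction (λ {x} → ⊆-trans T⊆s s⊆s′ {x}) T⊈s′
... | no  _   | _        = z≤n

contained-mono : ∀ {m} (Ts : List (Subset m)) {s s′} → s ⊆ s′ → contained Ts s ≤ contained Ts s′
contained-mono []       s⊆s′ = z≤n
contained-mono (T ∷ Ts) s⊆s′ = +-mono-≤ (⟦⊆⟧-mono T s⊆s′) (contained-mono Ts s⊆s′)

spoilAll-∣∣ : ∀ {m} (Ts : List (Subset m)) s → ∣ s ∣ ≤ contained Ts s + ∣ spoilAll Ts s ∣
spoilAll-∣∣ []       s = ≤-refl
spoilAll-∣∣ (T ∷ Ts) s = begin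
  ∣ s ∣                                             ≤⟨ spoil-∣∣ T s ⟩
  ⟦ T ⊆ s ⟧ + ∣ s₁ ∣                                 ≤⟨ +-monoʳ-≤ ⟦ T ⊆ s ⟧ (spoilAll-∣∣ Ts s₁) ⟩
  ⟦ T ⊆ s ⟧ + (contained Ts s₁ + ∣ spoilAll Ts s₁ ∣)
    ≤⟨ +-monoʳ-≤ ⟦ T ⊆ s ⟧ (+-monoˡ-≤ _ (contained-mono Ts (spoil-⊆ T s))) ⟩
  ⟦ T ⊆ s ⟧ + (contained Ts s + ∣ spoilAll Ts s₁ ∣)  ≡⟨ +-assoc ⟦ T ⊆ s ⟧ _ _ ⟨
  ⟦ T ⊆ s ⟧ + contained Ts s + ∣ spoilAll Ts s₁ ∣    ∎
  where
  open ≤-Reasoning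
  s₁ = spoil T s

spoilAll-⊈ : ∀ {m} (Ts : List (Subset m)) s → All (λ T → 1 ≤ ∣ T ∣) Ts → All (λ T → T ⊈ spoilAll Ts s) Ts
spoilAll-⊈ []       s []           = []
spoilAll-⊈ (T ∷ Ts) s (1≤∣T∣ ∷ hs) =
  (λ T⊆ → spoil-⊈ T s 1≤∣T∣ (⊆-trans T⊆ (spoilAll-⊆ Ts (spoil T s)))) ∷ spoilAll-⊈ Ts (spoil T s) hs

injection⇒≤∣p∣ : ∀ {k m} {p : Subset m} (g : Fin k → Fin m) →
                 Injective _≡_ _≡_ g → (∀ j → g j ∈ₛ p) → k ≤ ∣ p ∣
injection⇒≤∣p∣ {zero}              g _   _   = z≤n
injection⇒≤∣p∣ {suc k} {zero}      g _   _   with () ← g zero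
injection⇒≤∣p∣ {suc k} {suc m} {x ∷ p} g inj g∈p with any? (λ j → g j ≟ zero)
... | no ∄j = ≤-trans (injection⇒≤∣p∣ g′ g′-injective g′∈p) (∣p∣≤∣x∷p∣ x p)
  where
  0≢g : ∀ j → zero ≢ g j
  0≢g j 0≡gj = ∄j (j , sym 0≡gj)
  g′ : Fin (suc k) → Fin m
  g′ j = punchOut (0≢g j)
  g′-injective : Injective _≡_ _≡_ g′
  g′-injective eq = inj (punchOut-injective (0≢g _) (0≢g _) eq)
  g′∈p : ∀ j → g′ j ∈ₛ p
  g′∈p j = drop-there (subst (_∈ₛ x ∷ p) (sym (punchIn-punchOut (0≢g j))) (g∈p j))
... | yes (j₀ , gj₀≡0) with x | subst (_∈ₛ x ∷ p) gj₀≡0 (g∈p j₀) | g∈p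
...   | inside | here | g∈p′ = s≤s (injection⇒≤∣p∣ g′ g′-injective g′∈p)
  where
  0≢g : ∀ i → zero ≢ g (punchIn j₀ i)
  0≢g i 0≡g = punchInᵢ≢i j₀ i (inj (trans (sym 0≡g) (sym gj₀≡0)))
  g′ : Fin k → Fin m
  g′ i = punchOut (0≢g i)
  g′-injective : Injective _≡_ _≡_ g′
  g′-injective eq = punchIn-injective j₀ _ _ (inj (punchOut-injective (0≢g _) (0≢g _) eq))
  g′∈p : ∀ i → g′ i ∈ₛ p
  g′∈p i = drop-there (subst (_∈ₛ inside ∷ p) (sym (punchIn-punchOut (0≢g i))) (g∈p′ (punchIn j₀ i)))

-- Weighted sums over subsets and the deletion method

module WeightedSum (a c : ℕ) where

  b : ℕ
  b = a + c

  -- b ^ m times the expected value of F s, for a random s ⊆ Fin m containing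
  -- each point independently with probability a / b.
  weightedSum : ∀ {m} → (Subset m → ℕ) → ℕ
  weightedSum {zero}  F = F []
  weightedSum {suc m} F = a * weightedSum (F ∘ (inside ∷_)) + c * weightedSum (F ∘ (outside ∷_))

  weightedSum-mono : ∀ {m} {F G : Subset m → ℕ} → (∀ s → F s ≤ G s) → weightedSum F ≤ weightedSum G
  weightedSum-mono {zero}  F≤G = F≤G []
  weightedSum-mono {suc m} F≤G =
    +-mono-≤ (*-monoʳ-≤ a (weightedSum-mono (F≤G ∘ (inside ∷_))))
             (*-monoʳ-≤ c (weightedSum-mono (F≤G ∘ (outside ∷_))))

  weightedSum-+ : ∀ {m} (F G : Subset m → ℕ) →
                  weightedSum (λ s → F s + G s) ≡ weightedSum F + weightedSum G
  weightedSum-+ {zero}  F G = refl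
  weightedSum-+ {suc m} F G =
    trans (cong₂ (λ x y → a * x + c * y) (weightedSum-+ (F ∘ (inside ∷_)) (G ∘ (inside ∷_)))
                                        (weightedSum-+ (F ∘ (outside ∷_)) (G ∘ (outside ∷_))))
          (regroup a c _ _ _ _)
    where
    regroup : ∀ a c x y z w → a * (x + y) + c * (z + w) ≡ (a * x + c * z) + (a * y + c * w)
    regroup = solve-∀

  private
    mix : ∀ x → a * x + c * x ≡ b * x
    mix x = sym (*-distribʳ-+ x a c)

    mix-≤ : ∀ {x y z} → x ≤ z → y ≤ z → a * x + c * y ≤ b * z
    mix-≤ {z = z} x≤z y≤z = ≤-trans (+-mono-≤ (*-monoʳ-≤ a x≤z) (*-monoʳ-≤ c y≤z)) (≤-reflexive (mix z))

  weightedSum-const : ∀ {m} k → weightedSum {m} (const k) ≡ b ^ m * k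
  weightedSum-const {zero}  k = sym (*-identityˡ k)
  weightedSum-const {suc m} k = begin
    a * W + c * W   ≡⟨ mix W ⟩
    b * W           ≡⟨ cong (b *_) (weightedSum-const {m} k) ⟩
    b * (b ^ m * k) ≡⟨ *-assoc b (b ^ m) k ⟨
    b * b ^ m * k   ∎
    where
    open ≡-Reasoning
    W = weightedSum {m} (const k)

  weightedSum-witness : ∀ {m} (F : Subset m → ℕ) → ∃ λ s → weightedSum F ≤ b ^ m * F s
  weightedSum-witness {zero}  F = [] , ≤-reflexive (sym (*-identityˡ (F [])))
  weightedSum-witness {suc m} F
    with s₁ , h₁ ← weightedSum-witness (F ∘ (inside ∷_))
       | s₀ , h₀ ← weightedSum-witness (F ∘ (outside ∷_))
    with ≤-total (F (inside ∷ s₁)) (F (outside ∷ s₀))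
  ... | inj₁ F₁≤F₀ = outside ∷ s₀ , ≤-trans (mix-≤ (≤-trans h₁ (*-monoʳ-≤ (b ^ m) F₁≤F₀)) h₀)
                                            (≤-reflexive (sym (*-assoc b (b ^ m) _)))
  ... | inj₂ F₀≤F₁ = inside ∷ s₁ , ≤-trans (mix-≤ h₁ (≤-trans h₀ (*-monoʳ-≤ (b ^ m) F₀≤F₁)))
                                           (≤-reflexive (sym (*-assoc b (b ^ m) _)))

  weightedSum-∣∣ : ∀ {m} → b * weightedSum {m} ∣_∣ ≡ m * a * b ^ m
  weightedSum-∣∣ {zero}  = *-zeroʳ b
  weightedSum-∣∣ {suc m} = begin
    b * (a * weightedSum {m} (λ s → 1 + ∣ s ∣) + c * W)
      ≡⟨ cong (λ x → b * (a * x + c * W)) (weightedSum-+ {m} (const 1) ∣_∣) ⟩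
    b * (a * (weightedSum {m} (const 1) + W) + c * W)
      ≡⟨ cong (λ x → b * (a * (x + W) + c * W)) (weightedSum-const {m} 1) ⟩
    b * (a * (b ^ m * 1 + W) + c * W)      ≡⟨ expand a c (b ^ m) W ⟩
    a * (b * b ^ m) + b * (b * W)          ≡⟨ cong (λ x → a * (b * b ^ m) + b * x) (weightedSum-∣∣ {m}) ⟩
    a * (b * b ^ m) + b * (m * a * b ^ m)  ≡⟨ collect a b m (b ^ m) ⟩
    suc m * a * (b * b ^ m)                ∎
    where
    open ≡-Reasoning
    W = weightedSum {m} ∣_∣
    expand : ∀ a c x w → (a + c) * (a * (x * 1 + w) + c * w) ≡ a * ((a + c) * x) + (a + c) * ((a + c) * w)
    expand = solve-∀
    collect : ∀ a b m x → a * (b * x) + b * (m * a * x) ≡ (1 + m) * a * (b * x)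
    collect = solve-∀

  weightedSum-≤1 : ∀ {m} {F : Subset m → ℕ} → (∀ s → F s ≤ 1) → weightedSum F ≤ b ^ m
  weightedSum-≤1 {m} F≤1 = ≤-trans (weightedSum-mono F≤1) (≤-reflexive (trans (weightedSum-const {m} 1) (*-identityʳ _)))

  weightedSum-⊆ : ∀ {m} k (T : Subset m) → k ≤ ∣ T ∣ →
                  b ^ k * weightedSum (λ s → ⟦ T ⊆ s ⟧) ≤ a ^ k * b ^ m
  weightedSum-⊆ {m} zero T _ = *-monoʳ-≤ 1 (weightedSum-≤1 (⟦⊆⟧≤1 T))
  weightedSum-⊆ {suc m} k@(suc _) (outside ∷ T) k≤∣T∣ = begin
    b ^ k * (a * W + c * W) ≡⟨ cong (b ^ k *_) (mix W) ⟩
    b ^ k * (b * W)         ≡⟨ x∙yz≈y∙xz (b ^ k) b W ⟩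
    b * (b ^ k * W)         ≤⟨ *-monoʳ-≤ b (weightedSum-⊆ k T k≤∣T∣) ⟩
    b * (a ^ k * b ^ m)     ≡⟨ x∙yz≈y∙xz b (a ^ k) (b ^ m) ⟩
    a ^ k * (b * b ^ m)     ∎
    where
    open ≤-Reasoning
    W = weightedSum {m} (λ s → ⟦ T ⊆ s ⟧)
  weightedSum-⊆ {suc m} (suc k) (inside ∷ T) (s≤s k≤∣T∣) = begin
    b * b ^ k * (a * W + c * weightedSum {m} (const 0)) ≡⟨ cong (λ x → b * b ^ k * (a * W + c * x)) (weightedSum-const {m} 0) ⟩
    b * b ^ k * (a * W + c * (b ^ m * 0))             ≡⟨ rearrange b (b ^ k) a W c (b ^ m) ⟩
    a * b * (b ^ k * W)                                ≤⟨ *-monoʳ-≤ (a * b) (weightedSum-⊆ k T k≤∣T∣) ⟩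
    a * b * (a ^ k * b ^ m)                            ≡⟨ rearrange′ a b (a ^ k) (b ^ m) ⟩
    a * a ^ k * (b * b ^ m)                            ∎
    where
    open ≤-Reasoning
    W = weightedSum {m} (λ s → ⟦ T ⊆ s ⟧)
    rearrange : ∀ b x a w c y → b * x * (a * w + c * (y * 0)) ≡ a * b * (x * w)
    rearrange = solve-∀
    rearrange′ : ∀ a b x y → a * b * (x * y) ≡ a * x * (b * y)
    rearrange′ = solve-∀

  weightedSum-contained : ∀ {m} k (Ts : List (Subset m)) → All (λ T → k ≤ ∣ T ∣) Ts →
                          b ^ k * weightedSum (contained Ts) ≤ length Ts * (a ^ k * b ^ m)
  weightedSum-contained {m} k []       []           =
    ≤-reflexive (trans (cong (b ^ k *_) (trans (weightedSum-const {m} 0) (*-zeroʳ (b ^ m)))) (*-zeroʳ (b ^ k)))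
  weightedSum-contained {m} k (T ∷ Ts) (k≤∣T∣ ∷ ks) = begin
    b ^ k * weightedSum (λ s → ⟦ T ⊆ s ⟧ + contained Ts s)
      ≡⟨ cong (b ^ k *_) (weightedSum-+ (λ s → ⟦ T ⊆ s ⟧) (contained Ts)) ⟩
    b ^ k * (weightedSum (λ s → ⟦ T ⊆ s ⟧) + weightedSum (contained Ts))
      ≡⟨ *-distribˡ-+ (b ^ k) _ _ ⟩
    b ^ k * weightedSum (λ s → ⟦ T ⊆ s ⟧) + b ^ k * weightedSum (contained Ts)
      ≤⟨ +-mono-≤ (weightedSum-⊆ k T k≤∣T∣) (weightedSum-contained k Ts ks) ⟩
    a ^ k * b ^ m + length Ts * (a ^ k * b ^ m)
      ∎
    where open ≤-Reasoning

deletion-method : ∀ {m} a c k (Ts : List (Subset m)) → .⦃ _ : NonZero (a + c) ⦄ → 1 ≤ k → All (λ T → k ≤ ∣ T ∣) Ts →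
  ∃ λ s → All (λ T → T ⊈ s) Ts ×
          m * a * (a + c) ^ k ≤ (a + c) ^ k * (a + c) * ∣ s ∣ + (a + c) * length Ts * a ^ k
deletion-method {m} a c k Ts 1≤k large =
  s′ , spoilAll-⊈ Ts s (All.map (≤-trans 1≤k) large) , *-cancelˡ-≤ (b ^ m) ⦃ m^n≢0 b m ⦄ (begin
    b ^ m * (m * a * b ^ k)
      ≡⟨ regroup (b ^ m) m a (b ^ k) ⟩
    b ^ k * (m * a * b ^ m)
      ≡⟨ cong (b ^ k *_) (weightedSum-∣∣ {m}) ⟨
    b ^ k * (b * weightedSum {m} ∣_∣)
      ≤⟨ *-monoʳ-≤ (b ^ k) (*-monoʳ-≤ b (weightedSum-mono (spoilAll-∣∣ Ts))) ⟩
    b ^ k * (b * weightedSum (λ s → contained Ts s + F s))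
      ≡⟨ cong (λ x → b ^ k * (b * x)) (weightedSum-+ (contained Ts) F) ⟩
    b ^ k * (b * (weightedSum (contained Ts) + weightedSum F))
      ≡⟨ regroup′ (b ^ k) b (weightedSum (contained Ts)) (weightedSum F) ⟩
    b * (b ^ k * weightedSum (contained Ts)) + b ^ k * b * weightedSum F
      ≤⟨ +-mono-≤ (*-monoʳ-≤ b (weightedSum-contained k Ts large)) (*-monoʳ-≤ (b ^ k * b) s-good) ⟩
    b * (length Ts * (a ^ k * b ^ m)) + b ^ k * b * (b ^ m * F s)
      ≡⟨ regroup″ b (length Ts) (a ^ k) (b ^ m) (b ^ k) (F s) ⟩
    b ^ m * (b ^ k * b * ∣ s′ ∣ + b * length Ts * a ^ k)
      ∎)
  where
  open WeightedSum a c
  open ≤-Reasoning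
  F : Subset m → ℕ
  F s = ∣ spoilAll Ts s ∣
  witness = weightedSum-witness F
  s = proj₁ witness
  s-good = proj₂ witness
  s′ = spoilAll Ts s
  regroup : ∀ x m a y → x * (m * a * y) ≡ y * (m * a * x)
  regroup = solve-∀
  regroup′ : ∀ y b u v → y * (b * (u + v)) ≡ b * (y * u) + y * b * v
  regroup′ = solve-∀
  regroup″ : ∀ b l z x y f → b * (l * (z * x)) + y * b * (x * f) ≡ x * (y * b * f + b * l * z)
  regroup″ = solve-∀

does⇒ : ∀ {P : Set} (P? : Dec P) → does P? ≡ true → P
does⇒ (yes p) _ = p

length-cartesianProductWith : ∀ {A B C : Set} (f : A → B → C) xs ys →
                              length (cartesianProductWith f xs ys) ≡ length xs * length ys
length-cartesianProductWith f []       ys = refl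
length-cartesianProductWith f (x ∷ xs) ys =
  trans (length-++ (map (f x) ys)) (cong₂ _+_ (length-map (f x) ys) (length-cartesianProductWith f xs ys))

allVecs : ∀ {A : Set} k → List A → List (Vec A k)
allVecs zero    xs = [] ∷ []
allVecs (suc k) xs = cartesianProductWith _∷_ xs (allVecs k xs)

length-allVecs : ∀ {A : Set} k (xs : List A) → length (allVecs k xs) ≡ length xs ^ k
length-allVecs zero    xs = refl
length-allVecs (suc k) xs =
  trans (length-cartesianProductWith _∷_ xs (allVecs k xs)) (cong (length xs *_) (length-allVecs k xs))

∈-allVecs : ∀ {A : Set} {k} {xs : List A} (v : Vec A k) → (∀ i → Vec.lookup v i ∈ xs) → v ∈ allVecs k xs
∈-allVecs []       _  = here refl
∈-allVecs (x ∷ v) v∈ = ∈-cartesianProductWith⁺ _∷_ (v∈ zero) (∈-allVecs v (v∈ ∘ suc))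

Unique⇒lookup-injective : ∀ {A : Set} {xs : List A} → Unique xs → ∀ i j → lookup xs i ≡ lookup xs j → i ≡ j
Unique⇒lookup-injective (_  ∷ _) zero    zero    _  = refl
Unique⇒lookup-injective (x∉ ∷ _) zero    (suc j) eq = contradiction eq (All.lookup x∉ (∈-lookup j))
Unique⇒lookup-injective (x∉ ∷ _) (suc i) zero    eq = contradiction (sym eq) (All.lookup x∉ (∈-lookup i))
Unique⇒lookup-injective (_  ∷ u) (suc i) (suc j) eq = cong suc (Unique⇒lookup-injective u i j eq)

chosen : ∀ {A : Set} (xs : List A) → Subset (length xs) → List A
chosen []       []            = []
chosen (x ∷ xs) (inside  ∷ s) = x ∷ chosen xs s
chosen (x ∷ xs) (outside ∷ s) = chosen xs s

length-chosen : ∀ {A : Set} (xs : List A) s → length (chosen xs s) ≡ ∣ s ∣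
length-chosen []       []            = refl
length-chosen (x ∷ xs) (inside  ∷ s) = cong suc (length-chosen xs s)
length-chosen (x ∷ xs) (outside ∷ s) = length-chosen xs s

chosen-⊆ : ∀ {A : Set} (xs : List A) s → chosen xs s Sublist.⊆ xs
chosen-⊆ []       []            = []
chosen-⊆ (x ∷ xs) (inside  ∷ s) = refl ∷ chosen-⊆ xs s
chosen-⊆ (x ∷ xs) (outside ∷ s) = x ∷ʳ chosen-⊆ xs s

∈-chosen : ∀ {A : Set} {xs : List A} {s y} → y ∈ chosen xs s → y ∈ xs
∈-chosen {xs = xs} {s} = Sublist.lookup (chosen-⊆ xs s)

lookup∈chosen⇒∈ : ∀ {A : Set} {xs : List A} {s} → Unique xs → ∀ i → lookup xs i ∈ chosen xs s → i ∈ₛ s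
lookup∈chosen⇒∈ {xs = x ∷ xs} {inside  ∷ s} _           zero    _            = here
lookup∈chosen⇒∈ {xs = x ∷ xs} {outside ∷ s} (x∉ ∷ _)    zero    x∈           =
  contradiction refl (All.lookup x∉ (∈-chosen x∈))
lookup∈chosen⇒∈ {xs = x ∷ xs} {inside  ∷ s} (x∉ ∷ _)    (suc i) (here eq)    =
  contradiction (sym eq) (All.lookup x∉ (∈-lookup i))
lookup∈chosen⇒∈ {xs = x ∷ xs} {inside  ∷ s} (_ ∷ uniq)  (suc i) (there xᵢ∈) = there (lookup∈chosen⇒∈ uniq i xᵢ∈)
lookup∈chosen⇒∈ {xs = x ∷ xs} {outside ∷ s} (_ ∷ uniq)  (suc i) xᵢ∈         = there (lookup∈chosen⇒∈ uniq i xᵢ∈)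

-- Edges of a graph and its subgraphs

Pair : ℕ → Set
Pair n = Fin n × Fin n

allPairs : ∀ n → List (Pair n)
allPairs n = cartesianProduct (allFin n) (allFin n)

_∈?_ : ∀ {n} (p : Pair n) ps → Dec (p ∈ ps)
p ∈? ps = Any.any? (≡-dec _≟_ _≟_ p) ps

<ᵇ-true : ∀ {i j} → (i <ᵇ j) ≡ true → i < j
<ᵇ-true {i} {j} e = <ᵇ⇒< i j (Equivalence.from T-≡ e)

<ᵇ-false : ∀ {i j} → (i <ᵇ j) ≡ false → j ≤ i
<ᵇ-false e = ≮⇒≥ (λ i<j → subst T e (<⇒<ᵇ i<j))

orient : ∀ {n} → Fin n → Fin n → Pair n
orient x y = if toℕ x <ᵇ toℕ y then (x , y) else (y , x)

orient-cases : ∀ {n} (x y : Fin n) → orient x y ≡ (x , y) ⊎ orient x y ≡ (y , x)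
orient-cases x y with toℕ x <ᵇ toℕ y
... | true  = inj₁ refl
... | false = inj₂ refl

orient-comm : ∀ {n} (x y : Fin n) → orient x y ≡ orient y x
orient-comm x y with toℕ x <ᵇ toℕ y in x<y | toℕ y <ᵇ toℕ x in y<x
... | true  | true  = contradiction (<ᵇ-true {toℕ x} x<y) (<-asym (<ᵇ-true {toℕ y} y<x))
... | true  | false = refl
... | false | true  = refl
... | false | false with refl ← toℕ-injective {i = x} {j = y} (≤-antisym (<ᵇ-false y<x) (<ᵇ-false x<y)) = refl

orient-< : ∀ {n} {x y : Fin n} → toℕ x < toℕ y → orient x y ≡ (x , y)
orient-< {x = x} {y} x<y with toℕ x <ᵇ toℕ y in e
... | true  = refl
... | false = contradiction (<ᵇ-false e) (<⇒≱ x<y)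

orient-injective : ∀ {n} {x y x′ y′ : Fin n} → orient x y ≡ orient x′ y′ →
                   (x ≡ x′ × y ≡ y′) ⊎ (x ≡ y′ × y ≡ x′)
orient-injective {x = x} {y} {x′} {y′} eq with orient-cases x y | orient-cases x′ y′
... | inj₁ p | inj₁ q = inj₁ (,-injective (trans (sym p) (trans eq q)))
... | inj₁ p | inj₂ q = inj₂ (,-injective (trans (sym p) (trans eq q)))
... | inj₂ p | inj₁ q = inj₂ (swap (,-injective (trans (sym p) (trans eq q))))
... | inj₂ p | inj₂ q = inj₁ (swap (,-injective (trans (sym p) (trans eq q))))

module Edges {n} (G : Graph n) where

  isEdge : Pair n → Bool
  isEdge p = (toℕ (proj₁ p) <ᵇ toℕ (proj₂ p)) ∧ adj G (proj₁ p) (proj₂ p)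

  edges : List (Pair n)
  edges = filterᵇ isEdge (allPairs n)

  ∈-edges⁻ : ∀ {x y} → (x , y) ∈ edges → toℕ x < toℕ y × adj G x y ≡ true
  ∈-edges⁻ {x} {y} xy∈ with x<y , xy ← Equivalence.to T-∧ (proj₂ (∈-filter⁻ (T? ∘ isEdge) {xs = allPairs n} xy∈)) =
    <ᵇ⇒< (toℕ x) (toℕ y) x<y , Equivalence.to T-≡ xy

  ∈-edges⁺ : ∀ {x y} → toℕ x < toℕ y → adj G x y ≡ true → (x , y) ∈ edges
  ∈-edges⁺ {x} {y} x<y xy = ∈-filter⁺ (T? ∘ isEdge) (∈-cartesianProduct⁺ (∈-allFin x) (∈-allFin y))
                                      (Equivalence.from T-∧ (<⇒<ᵇ x<y , Equivalence.from T-≡ xy))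

  edges-unique : Unique edges
  edges-unique = Unique.filter⁺ (T? ∘ isEdge) {allPairs n} (cartesianProduct⁺ (allFin⁺ n) (allFin⁺ n))

  orient∈edges : ∀ {x y} → adj G x y ≡ true → x ≢ y → orient x y ∈ edges
  orient∈edges {x} {y} xy x≢y with toℕ x <ᵇ toℕ y in x<y
  ... | true  = ∈-edges⁺ (<ᵇ-true x<y) xy
  ... | false = ∈-edges⁺ (≤∧≢⇒< (<ᵇ-false x<y) (x≢y ∘ sym ∘ toℕ-injective)) (trans (adj-sym G y x) xy)

  orient∈edges⇒adj : ∀ {x y} → orient x y ∈ edges → adj G x y ≡ true
  orient∈edges⇒adj {x} {y} o∈ with orient-cases x y
  ... | inj₁ o≡xy = proj₂ (∈-edges⁻ (subst (_∈ edges) o≡xy o∈))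
  ... | inj₂ o≡yx = trans (adj-sym G x y) (proj₂ (∈-edges⁻ (subst (_∈ edges) o≡yx o∈)))

  orient-diag∉edges : ∀ x → orient x x ∉ edges
  orient-diag∉edges x o∈ with () ← trans (sym (adj-irrefl G x)) (orient∈edges⇒adj o∈)

  subgraph : Subset (length edges) → Graph n
  subgraph s = record
    { adj    = λ x y → does (orient x y ∈? chosen edges s)
    ; sym    = λ x y → cong (λ p → does (p ∈? chosen edges s)) (orient-comm x y)
    ; irrefl = λ x → dec-false (orient x x ∈? chosen edges s) (orient-diag∉edges x ∘ ∈-chosen)
    }

  subgraph-adj⁻ : ∀ s {x y} → adj (subgraph s) x y ≡ true → orient x y ∈ chosen edges s
  subgraph-adj⁻ s {x} {y} xy = does⇒ (orient x y ∈? chosen edges s) xy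

  subgraph-⊆ : ∀ s → subgraph s ⊆G G
  subgraph-⊆ s x y xy = orient∈edges⇒adj (∈-chosen (subgraph-adj⁻ s xy))

  ∣s∣≤edgeCount[subgraph] : ∀ s → ∣ s ∣ ≤ edgeCount (subgraph s)
  ∣s∣≤edgeCount[subgraph] s = begin
    ∣ s ∣                                ≡⟨ length-chosen edges s ⟨
    length (chosen edges s)              ≡⟨ cong length (filter-all (T? ∘ isEdgeᴴ) (All.tabulate chosen-isEdgeᴴ)) ⟨
    length (filterᵇ isEdgeᴴ (chosen edges s))
      ≤⟨ length-mono-≤ (filter⁺ (T? ∘ isEdgeᴴ) (T? ∘ isEdgeᴴ) (λ { refl → id }) chosen⊆pairs) ⟩
    edgeCount (subgraph s)               ∎
    where
    open ≤-Reasoning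
    isEdgeᴴ : Pair n → Bool
    isEdgeᴴ p = (toℕ (proj₁ p) <ᵇ toℕ (proj₂ p)) ∧ adj (subgraph s) (proj₁ p) (proj₂ p)
    chosen⊆pairs : chosen edges s Sublist.⊆ allPairs n
    chosen⊆pairs = Sublist.⊆-trans (chosen-⊆ edges s) (filter-⊆ (T? ∘ isEdge) _)
    chosen-isEdgeᴴ : ∀ {p} → p ∈ chosen edges s → T (isEdgeᴴ p)
    chosen-isEdgeᴴ {x , y} p∈ with x<y , _ ← ∈-edges⁻ (∈-chosen p∈) =
      Equivalence.from T-∧ (<⇒<ᵇ x<y , Equivalence.from T-≡ (dec-true (orient x y ∈? chosen edges s) o∈))
      where
      o∈ : orient x y ∈ chosen edges s
      o∈ = subst (_∈ chosen edges s) (sym (orient-< x<y)) p∈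

  -- A code v lists the pairs (a_x , b_x); it stands for the K_{r,r} with parts {a_x} and {b_y}.
  copyEdge : ∀ {r} → Vec (Pair n) r → Fin r × Fin r → Pair n
  copyEdge v (x , y) = orient (proj₁ (Vec.lookup v x)) (proj₂ (Vec.lookup v y))

  copyEdges : ∀ {r} → Vec (Pair n) r → List (Pair n)
  copyEdges {r} v = map (copyEdge v) (allPairs r)

  length-copyEdges : ∀ {r} (v : Vec (Pair n) r) → length (copyEdges v) ≡ r * r
  length-copyEdges {r} v = trans (length-map (copyEdge v) (allPairs r))
    (trans (length-cartesianProductWith _,_ (allFin r) (allFin r))
           (cong₂ _*_ (length-tabulate {n = r} id) (length-tabulate {n = r} id)))

  Genuine : ∀ {r} → Vec (Pair n) r → Set
  Genuine v = Unique (copyEdges v) × All (_∈ edges) (copyEdges v)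

  genuine? : ∀ {r} (v : Vec (Pair n) r) → Dec (Genuine v)
  genuine? v = unique? (≡-dec _≟_ _≟_) (copyEdges v) ×-dec All.all? (_∈? edges) (copyEdges v)

  positions : ∀ {r} → Vec (Pair n) r → Subset (length edges)
  positions v = Vec.tabulate (λ i → does (lookup edges i ∈? copyEdges v))

  ∈-positions⁺ : ∀ {r} {v : Vec (Pair n) r} i → lookup edges i ∈ copyEdges v → i ∈ₛ positions v
  ∈-positions⁺ {v = v} i e∈ = lookup⇒[]= i _ (trans (lookup∘tabulate _ i) (dec-true (lookup edges i ∈? copyEdges v) e∈))

  ∈-positions⁻ : ∀ {r} {v : Vec (Pair n) r} i → i ∈ₛ positions v → lookup edges i ∈ copyEdges v
  ∈-positions⁻ {v = v} i i∈ = does⇒ (lookup edges i ∈? copyEdges v) (trans (sym (lookup∘tabulate _ i)) ([]=⇒lookup i∈))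

  ∣positions∣ : ∀ {r} (v : Vec (Pair n) r) → Genuine v → r * r ≤ ∣ positions v ∣
  ∣positions∣ {r} v (unique , ⊆edges) =
    subst (_≤ ∣ positions v ∣) (length-copyEdges v) (injection⇒≤∣p∣ g g-injective g∈)
    where
    position : ∀ j → lookup (copyEdges v) j ∈ edges
    position j = All.lookup ⊆edges (∈-lookup j)
    g : Fin (length (copyEdges v)) → Fin (length edges)
    g j = index (position j)
    g-injective : ∀ {i j} → g i ≡ g j → i ≡ j
    g-injective {i} {j} gi≡gj = Unique⇒lookup-injective unique i j
      (trans (lookup-index (position i)) (trans (cong (lookup edges) gi≡gj) (sym (lookup-index (position j)))))
    g∈ : ∀ j → g j ∈ₛ positions v
    g∈ j = ∈-positions⁺ {v = v} (g j) (subst (_∈ copyEdges v) (lookup-index (position j)) (∈-lookup j))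

  arcs : List (Pair n)
  arcs = edges ++ map swap edges

  ∈-arcs : ∀ {x y} → adj G x y ≡ true → x ≢ y → (x , y) ∈ arcs
  ∈-arcs {x} {y} xy x≢y with orient-cases x y
  ... | inj₁ o≡xy = ∈-++⁺ˡ (subst (_∈ edges) o≡xy (orient∈edges xy x≢y))
  ... | inj₂ o≡yx = ∈-++⁺ʳ edges (∈-map⁺ swap (subst (_∈ edges) o≡yx (orient∈edges xy x≢y)))

  codes : ∀ r → List (Vec (Pair n) r)
  codes r = allVecs r arcs

  module Copy {r} (f : Fin r ⊎ Fin r → Fin n) (f-injective : Injective _≡_ _≡_ f)
              (f-adj : ∀ x y → adj G (f (inj₁ x)) (f (inj₂ y)) ≡ true) where

    a b : Fin r → Fin n
    a = f ∘ inj₁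
    b = f ∘ inj₂

    a≢b : ∀ x y → a x ≢ b y
    a≢b x y ax≡by with () ← f-injective ax≡by

    code : Vec (Pair n) r
    code = Vec.tabulate (λ x → a x , b x)

    copyEdge-code : ∀ xy → copyEdge code xy ≡ orient (a (proj₁ xy)) (b (proj₂ xy))
    copyEdge-code (x , y) = cong₂ orient (cong proj₁ (lookup∘tabulate _ x)) (cong proj₂ (lookup∘tabulate _ y))

    ∈-copyEdges⁻ : ∀ {e} → e ∈ copyEdges code → ∃ λ xy → e ≡ orient (a (proj₁ xy)) (b (proj₂ xy))
    ∈-copyEdges⁻ e∈ with xy , _ , e≡ ← ∈-map⁻ (copyEdge code) {xs = allPairs r} e∈ = xy , trans e≡ (copyEdge-code xy)

    code∈codes : code ∈ codes r
    code∈codes = ∈-allVecs code λ x → subst (_∈ arcs) (sym (lookup∘tabulate _ x)) (∈-arcs (f-adj x x) (a≢b x x))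

    copyEdge-injective : ∀ {xy x′y′} → copyEdge code xy ≡ copyEdge code x′y′ → xy ≡ x′y′
    copyEdge-injective {x , y} {x′ , y′} eq
      with orient-injective (trans (sym (copyEdge-code (x , y))) (trans eq (copyEdge-code (x′ , y′))))
    ... | inj₁ (ax≡ax′ , by≡by′) =
      cong₂ _,_ (inj₁-injective (f-injective ax≡ax′)) (inj₂-injective (f-injective by≡by′))
    ... | inj₂ (ax≡by′ , _)      = contradiction ax≡by′ (a≢b x y′)

    code-genuine : Genuine code
    code-genuine = Unique.map⁺ copyEdge-injective (cartesianProduct⁺ (allFin⁺ r) (allFin⁺ r))
                 , All.tabulate (λ e∈ → case ∈-copyEdges⁻ e∈ of λ where
                     ((x , y) , refl) → orient∈edges (f-adj x y) (a≢b x y))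

  copies : ∀ r → List (Subset (length edges))
  copies r = map positions (filter genuine? (codes r))

  length-copies : ∀ r → length (copies r) ≤ (edgeCount G + edgeCount G) ^ r
  length-copies r = begin
    length (copies r)                     ≡⟨ length-map positions (filter genuine? (codes r)) ⟩
    length (filter genuine? (codes r))    ≤⟨ length-filter genuine? (codes r) ⟩
    length (allVecs r arcs)               ≡⟨ length-allVecs r arcs ⟩
    length arcs ^ r                       ≡⟨ cong (_^ r) (trans (length-++ edges) (cong (length edges +_) (length-map swap edges))) ⟩
    (length edges + length edges) ^ r     ∎
    where open ≤-Reasoning

  copies-large : ∀ r → All (λ T → r * r ≤ ∣ T ∣) (copies r)
  copies-large r = All.tabulate λ T∈ → case ∈-map⁻ positions {xs = filter genuine? (codes r)} T∈ of λ where
    (v , v∈ , refl) → ∣positions∣ v (proj₂ (∈-filter⁻ genuine? {xs = codes r} v∈))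

  subgraph-K-free : ∀ r s → All (λ T → T ⊈ s) (copies r) → ¬ ContainsK r (subgraph s)
  subgraph-K-free r s avoids (f , f-injective , f-adj) =
    All.lookup avoids (∈-map⁺ positions (∈-filter⁺ genuine? {xs = codes r} code∈codes code-genuine)) positions⊆s
    where
    open Copy f f-injective (λ x y → subgraph-⊆ s _ _ (f-adj x y))
    positions⊆s : positions code ⊆ s
    positions⊆s {i} i∈ with (x , y) , e≡ ← ∈-copyEdges⁻ (∈-positions⁻ {v = code} i i∈) =
      lookup∈chosen⇒∈ edges-unique i (subst (_∈ chosen edges s) (sym e≡) (subgraph-adj⁻ s (f-adj x y)))

-- Choice of the sampling rate

^-distribʳ-* : ∀ x y n → (x * y) ^ n ≡ x ^ n * y ^ n
^-distribʳ-* x y zero    = refl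
^-distribʳ-* x y (suc n) = trans (cong ((x * y) *_) (^-distribʳ-* x y n)) (shuffle x y (x ^ n) (y ^ n))
  where
  shuffle : ∀ x y u v → x * y * (u * v) ≡ x * u * (y * v)
  shuffle = solve-∀

x≤x^[1+n] : ∀ x n → 1 ≤ x → x ≤ x ^ suc n
x≤x^[1+n] x n 1≤x = begin
  x         ≡⟨ *-identityʳ x ⟨
  x * 1     ≡⟨ cong (x *_) (^-zeroˡ n) ⟨
  x * 1 ^ n ≤⟨ *-monoʳ-≤ x (^-monoˡ-≤ n 1≤x) ⟩
  x * x ^ n ∎
  where open ≤-Reasoning

2^[3+q]≤3^[2+q] : ∀ q → 2 ^ (3 + q) ≤ 3 ^ (2 + q)
2^[3+q]≤3^[2+q] zero    = s≤s (s≤s (s≤s (s≤s (s≤s (s≤s (s≤s (s≤s z≤n)))))))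
2^[3+q]≤3^[2+q] (suc q) = *-mono-≤ (s≤s (s≤s (z≤n {1}))) (2^[3+q]≤3^[2+q] q)

-- (1 + 1/n)^k ≤ n / (n − k), cleared of denominators (n = k + d).
[1+n]^k*d≤n^[1+k] : ∀ k d → suc (k + d) ^ k * d ≤ (k + d) ^ suc k
[1+n]^k*d≤n^[1+k] zero    d = ≤-reflexive (trans (*-identityˡ d) (sym (*-identityʳ d)))
[1+n]^k*d≤n^[1+k] (suc k) d = *-cancelˡ-≤ (suc d) (begin
  suc d * (suc n * suc n ^ k * d)  ≡⟨ regroup (suc d) (suc n ^ k) (suc n) d ⟩
  suc n ^ k * suc d * (suc n * d)  ≤⟨ *-monoˡ-≤ (suc n * d) ih ⟩
  n ^ suc k * (suc n * d)          ≤⟨ *-monoʳ-≤ (n ^ suc k) step ⟩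
  n ^ suc k * (n * suc d)          ≡⟨ regroup′ (n ^ suc k) n (suc d) ⟩
  suc d * (n * n ^ suc k)          ∎)
  where
  open ≤-Reasoning
  n = suc (k + d)
  ih : suc n ^ k * suc d ≤ n ^ suc k
  ih = subst (λ z → suc z ^ k * suc d ≤ z ^ suc k) (+-suc k d) ([1+n]^k*d≤n^[1+k] k (suc d))
  step : suc n * d ≤ n * suc d
  step = subst (suc n * d ≤_) (sym (*-suc n d)) (+-monoˡ-≤ (n * d) (m≤n+m d (suc k)))
  regroup : ∀ sd x sn d → sd * (sn * x * d) ≡ x * sd * (sn * d)
  regroup = solve-∀
  regroup′ : ∀ x n sd → x * (n * sd) ≡ sd * (n * x)
  regroup′ = solve-∀

2*[1+n]^k≤3*n^k : ∀ k n → 1 ≤ k → 3 * k ≤ n → 2 * suc n ^ k ≤ 3 * n ^ k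
2*[1+n]^k≤3*n^k k n 1≤k 3k≤n = subst (λ n → 2 * suc n ^ k ≤ 3 * n ^ k) (m+[n∸m]≡n k≤n) bound
  where
  k≤n : k ≤ n
  k≤n = ≤-trans (m≤n+m k (2 * k)) (≤-trans (≤-reflexive (+-comm (2 * k) k)) 3k≤n)
  d = n ∸ k
  2k≤d : 2 * k ≤ d
  2k≤d = subst (_≤ d) (m+n∸n≡m (2 * k) k) (∸-monoˡ-≤ k (≤-trans (≤-reflexive (triple k)) 3k≤n))
    where
    triple : ∀ k → 2 * k + k ≡ 3 * k
    triple = solve-∀
  instance
    k+d≢0 : NonZero (k + d)
    k+d≢0 = >-nonZero (≤-trans 1≤k (m≤m+n k d))
  bound : 2 * suc (k + d) ^ k ≤ 3 * (k + d) ^ k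
  bound = *-cancelˡ-≤ (k + d) (begin
    (k + d) * (2 * suc (k + d) ^ k) ≡⟨ regroup (k + d) (suc (k + d) ^ k) ⟩
    2 * (k + d) * suc (k + d) ^ k   ≤⟨ *-monoˡ-≤ (suc (k + d) ^ k) 2[k+d]≤3d ⟩
    3 * d * suc (k + d) ^ k         ≡⟨ regroup′ d (suc (k + d) ^ k) ⟩
    3 * (suc (k + d) ^ k * d)       ≤⟨ *-monoʳ-≤ 3 ([1+n]^k*d≤n^[1+k] k d) ⟩
    3 * ((k + d) * (k + d) ^ k)     ≡⟨ regroup″ (k + d) ((k + d) ^ k) ⟩
    (k + d) * (3 * (k + d) ^ k)     ∎)
    where
    open ≤-Reasoning
    triple′ : ∀ d → d + 2 * d ≡ 3 * d
    triple′ = solve-∀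
    2[k+d]≤3d : 2 * (k + d) ≤ 3 * d
    2[k+d]≤3d = begin
      2 * (k + d)   ≡⟨ *-distribˡ-+ 2 k d ⟩
      2 * k + 2 * d ≤⟨ +-monoˡ-≤ (2 * d) 2k≤d ⟩
      d + 2 * d     ≡⟨ triple′ d ⟩
      3 * d         ∎
    regroup : ∀ n x → n * (2 * x) ≡ 2 * n * x
    regroup = solve-∀
    regroup′ : ∀ d x → 3 * d * x ≡ 3 * (x * d)
    regroup′ = solve-∀
    regroup″ : ∀ n x → 3 * (n * x) ≡ n * (3 * x)
    regroup″ = solve-∀

root-bracket : ∀ k T j → 0 ^ k < T → T ≤ j ^ k → ∃ λ n → n ^ k < T × T ≤ suc n ^ k
root-bracket k T zero    0<T T≤0^k = contradiction T≤0^k (<⇒≱ 0<T)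
root-bracket k T (suc j) 0<T T≤    with T ≤? j ^ k
... | yes T≤j^k = root-bracket k T j 0<T T≤j^k
... | no  T≰j^k = j , ≰⇒> T≰j^k , T≤

-- Consecutive k-th powers beyond (4k)^k are within a factor 3/2 of each other.
power-window : ∀ k T → 1 ≤ k → (4 * k) ^ k ≤ T → ∃ λ b → 4 * k ≤ b × T ≤ b ^ k × 2 * b ^ k ≤ 3 * T
power-window k@(suc k′) T _ [4k]^k≤T = suc n , 4k≤1+n , T≤[1+n]^k , (begin
  2 * suc n ^ k ≤⟨ 2*[1+n]^k≤3*n^k k n (s≤s z≤n) 3k≤n ⟩
  3 * n ^ k     ≤⟨ *-monoʳ-≤ 3 (<⇒≤ n^k<T) ⟩
  3 * T         ∎)
  where
  open ≤-Reasoning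
  0<T : 0 < T
  0<T = <-≤-trans (m^n>0 (4 * k) k) [4k]^k≤T
  bracket = root-bracket k T T 0<T (x≤x^[1+n] T k′ 0<T)
  n = proj₁ bracket
  n^k<T = proj₁ (proj₂ bracket)
  T≤[1+n]^k = proj₂ (proj₂ bracket)
  4k≤1+n : 4 * k ≤ suc n
  4k≤1+n = ≮⇒≥ (λ 1+n<4k → <⇒≱ (^-monoˡ-< k 1+n<4k) (≤-trans [4k]^k≤T T≤[1+n]^k))
  3k≤n : 3 * k ≤ n
  3k≤n = ≤-pred (≤-trans (≤-reflexive (+-comm 1 (3 * k)))
                (≤-trans (+-monoʳ-≤ (3 * k) (s≤s z≤n)) (≤-trans (≤-reflexive (split k)) 4k≤1+n)))
    where
    split : ∀ k → 3 * k + k ≡ 4 * k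
    split = solve-∀

-- For p = a / b, the bound threshold q m a ≤ b ^ (r + 1) says p ^ (r + 1) ≤ 1 / (2 ^ (r + 2) m), r = 2 + q.
threshold : ℕ → ℕ → ℕ → ℕ
threshold q m a = 2 ^ (4 + q) * m * a ^ (3 + q)

module Rate (q m a b : ℕ) where

  r k θ : ℕ
  r = 2 + q
  k = 3 + q
  θ = threshold q m a

  x^[r*r]≡[x^k]^[r∸1]*x : ∀ x → x ^ (r * r) ≡ (x ^ k) ^ suc q * x
  x^[r*r]≡[x^k]^[r∸1]*x x = begin
    x ^ (r * r)             ≡⟨ cong (x ^_) (square q) ⟩
    x ^ (k * suc q + 1)     ≡⟨ ^-distribˡ-+-* x (k * suc q) 1 ⟩
    x ^ (k * suc q) * x ^ 1 ≡⟨ cong₂ _*_ (^-*-assoc x k (suc q)) (sym (*-identityʳ x)) ⟨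
    (x ^ k) ^ suc q * x     ∎
    where
    open ≡-Reasoning
    square : ∀ q → (2 + q) * (2 + q) ≡ (3 + q) * (1 + q) + 1
    square = solve-∀

  4*copies≤edges : θ ≤ b ^ k → 4 * (b * (m + m) ^ r * a ^ (r * r)) ≤ m * a * b ^ (r * r)
  4*copies≤edges θ≤b^k = begin
    4 * (b * (m + m) ^ r * a ^ (r * r))
      ≡⟨ cong₂ (λ u v → 4 * (b * u * v)) (trans (cong (_^ r) (double m)) (^-distribʳ-* 2 m r)) (x^[r*r]≡[x^k]^[r∸1]*x a) ⟩
    4 * (b * (2 ^ r * (m * m ^ suc q)) * ((a ^ k) ^ suc q * a))
      ≡⟨ regroup b (2 ^ r) m (m ^ suc q) ((a ^ k) ^ suc q) a ⟩
    P * (m * a * b * (m ^ suc q * (a ^ k) ^ suc q))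
      ≤⟨ *-monoˡ-≤ _ (x≤x^[1+n] P q (m^n>0 2 (suc k))) ⟩
    P ^ suc q * (m * a * b * (m ^ suc q * (a ^ k) ^ suc q))
      ≡⟨ regroup′ (P ^ suc q) (m * a * b) (m ^ suc q) ((a ^ k) ^ suc q) ⟩
    m * a * b * (P ^ suc q * m ^ suc q * (a ^ k) ^ suc q)
      ≡⟨ cong (m * a * b *_) (trans (^-distribʳ-* (P * m) (a ^ k) (suc q)) (cong (_* (a ^ k) ^ suc q) (^-distribʳ-* P m (suc q)))) ⟨
    m * a * b * θ ^ suc q
      ≤⟨ *-monoʳ-≤ (m * a * b) (^-monoˡ-≤ (suc q) θ≤b^k) ⟩
    m * a * b * (b ^ k) ^ suc q
      ≡⟨ regroup″ (m * a) b ((b ^ k) ^ suc q) ⟩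
    m * a * ((b ^ k) ^ suc q * b)
      ≡⟨ cong (m * a *_) (x^[r*r]≡[x^k]^[r∸1]*x b) ⟨
    m * a * b ^ (r * r)
      ∎
    where
    open ≤-Reasoning
    P = 2 ^ suc k
    double : ∀ m → m + m ≡ 2 * m
    double = solve-∀
    regroup : ∀ b p m mq aq a → 4 * (b * (p * (m * mq)) * (aq * a)) ≡ 2 * (2 * p) * (m * a * b * (mq * aq))
    regroup = solve-∀
    regroup′ : ∀ x y u v → x * (y * (u * v)) ≡ y * (x * u * v)
    regroup′ = solve-∀
    regroup″ : ∀ x b y → x * b * y ≡ x * (y * b)
    regroup″ = solve-∀

  3ma≤4bX : .⦃ _ : NonZero b ⦄ → θ ≤ b ^ k → ∀ X N → N ≤ (m + m) ^ r →
               m * a * b ^ (r * r) ≤ b ^ (r * r) * b * X + b * N * a ^ (r * r) → 3 * m * a ≤ 4 * b * X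
  3ma≤4bX θ≤b^k X N N≤ main = *-cancelˡ-≤ (b ^ (r * r)) ⦃ m^n≢0 b (r * r) ⦄ (begin
    b ^ (r * r) * (3 * m * a) ≡⟨ regroup (b ^ (r * r)) m a ⟩
    3 * M                     ≤⟨ +-cancelʳ-≤ M (3 * M) (4 * K) 3M+M≤4K+M ⟩
    4 * K                     ≡⟨ regroup′ (b ^ (r * r)) b X ⟩
    b ^ (r * r) * (4 * b * X) ∎)
    where
    open ≤-Reasoning
    M = m * a * b ^ (r * r)
    K = b ^ (r * r) * b * X
    regroup : ∀ y m a → y * (3 * m * a) ≡ 3 * (m * a * y)
    regroup = solve-∀
    regroup′ : ∀ y b x → 4 * (y * b * x) ≡ y * (4 * b * x)
    regroup′ = solve-∀
    four : ∀ x → 3 * x + x ≡ 4 * x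
    four = solve-∀
    3M+M≤4K+M : 3 * M + M ≤ 4 * K + M
    3M+M≤4K+M = begin
      3 * M + M                                ≡⟨ four M ⟩
      4 * M                                    ≤⟨ *-monoʳ-≤ 4 main ⟩
      4 * (K + b * N * a ^ (r * r))            ≡⟨ *-distribˡ-+ 4 K _ ⟩
      4 * K + 4 * (b * N * a ^ (r * r))        ≤⟨ +-monoʳ-≤ (4 * K) (*-monoʳ-≤ 4 (*-monoˡ-≤ (a ^ (r * r)) (*-monoʳ-≤ b N≤))) ⟩
      4 * K + 4 * (b * (m + m) ^ r * a ^ (r * r)) ≤⟨ +-monoʳ-≤ (4 * K) (4*copies≤edges θ≤b^k) ⟩
      4 * K + M                                ∎

  m^r≤[4X]^k : 1 ≤ m → 1 ≤ a → 2 * b ^ k ≤ 3 * θ → ∀ X → 3 * m * a ≤ 4 * b * X → m ^ r ≤ (4 * X) ^ k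
  m^r≤[4X]^k 1≤m 1≤a 2b^k≤3θ X kept =
    *-cancelˡ-≤ (3 ^ k) ⦃ m^n≢0 3 k ⦄ (*-cancelˡ-≤ (m * a ^ k) ⦃ >-nonZero (*-mono-≤ 1≤m (1≤x^n 1≤a)) ⦄ (begin
      m * a ^ k * (3 ^ k * m ^ r)         ≡⟨ regroup m (a ^ k) (3 ^ k) (m ^ r) ⟩
      3 ^ k * (m * m ^ r) * a ^ k         ≡⟨ trans (^-distribʳ-* (3 * m) a k) (cong (_* a ^ k) (^-distribʳ-* 3 m k)) ⟨
      (3 * m * a) ^ k                     ≤⟨ ^-monoˡ-≤ k kept ⟩
      (4 * b * X) ^ k                     ≡⟨ trans (cong (_^ k) (regroup′ b X)) (^-distribʳ-* (4 * X) b k) ⟩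
      (4 * X) ^ k * b ^ k                 ≤⟨ *-monoʳ-≤ ((4 * X) ^ k) b^k≤ ⟩
      (4 * X) ^ k * (3 * 2 ^ k * m * a ^ k)
        ≤⟨ *-monoʳ-≤ ((4 * X) ^ k) (*-monoˡ-≤ (a ^ k) (*-monoˡ-≤ m (*-monoʳ-≤ 3 (2^[3+q]≤3^[2+q] q)))) ⟩
      (4 * X) ^ k * (3 ^ k * m * a ^ k)   ≡⟨ regroup″ ((4 * X) ^ k) (3 ^ k) m (a ^ k) ⟩
      m * a ^ k * (3 ^ k * (4 * X) ^ k)   ∎))
    where
    open ≤-Reasoning
    1≤x^n : ∀ {x} → 1 ≤ x → 1 ≤ x ^ k
    1≤x^n {x} 1≤x = subst (_≤ x ^ k) (^-zeroˡ k) (^-monoˡ-≤ k 1≤x)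
    regroup : ∀ m y t z → m * y * (t * z) ≡ t * (m * z) * y
    regroup = solve-∀
    regroup′ : ∀ b x → 4 * b * x ≡ 4 * x * b
    regroup′ = solve-∀
    regroup″ : ∀ x t m y → x * (t * m * y) ≡ m * y * (t * x)
    regroup″ = solve-∀
    regroup‴ : ∀ t m y → 3 * (2 * t * m * y) ≡ 2 * (3 * t * m * y)
    regroup‴ = solve-∀
    b^k≤ : b ^ k ≤ 3 * 2 ^ k * m * a ^ k
    b^k≤ = *-cancelˡ-≤ 2 (≤-trans 2b^k≤3θ (≤-reflexive (regroup‴ (2 ^ k) m (a ^ k))))

rate-bracket : ∀ q m → 1 ≤ m → ∃₂ λ a b →
  1 ≤ a × a ≤ b × threshold q m a ≤ b ^ (3 + q) × 2 * b ^ (3 + q) ≤ 3 * threshold q m a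
rate-bracket q m 1≤m = a , b , s≤s z≤n , ≤-trans (*-monoˡ-≤ k (s≤s (s≤s (z≤n {2})))) 4k≤b , θ≤b^k , 2b^k≤3θ
  where
  k = 3 + q
  a = 2 * k
  [4k]^k≤θ : (4 * k) ^ k ≤ threshold q m a
  [4k]^k≤θ = begin
    (4 * k) ^ k             ≡⟨ cong (_^ k) (regroup k) ⟩
    (2 * a) ^ k             ≡⟨ ^-distribʳ-* 2 a k ⟩
    2 ^ k * a ^ k           ≡⟨ cong (_* a ^ k) (*-identityʳ (2 ^ k)) ⟨
    2 ^ k * 1 * a ^ k       ≤⟨ *-monoˡ-≤ (a ^ k) (*-monoʳ-≤ (2 ^ k) (≤-trans 1≤m (m≤n+m m m))) ⟩
    2 ^ k * (m + m) * a ^ k ≡⟨ cong (_* a ^ k) (regroup′ (2 ^ k) m) ⟩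
    2 * 2 ^ k * m * a ^ k   ∎
    where
    open ≤-Reasoning
    regroup : ∀ k → 4 * k ≡ 2 * (2 * k)
    regroup = solve-∀
    regroup′ : ∀ t m → t * (m + m) ≡ 2 * t * m
    regroup′ = solve-∀
  window = power-window k (threshold q m a) (s≤s z≤n) [4k]^k≤θ
  b = proj₁ window
  4k≤b = proj₁ (proj₂ window)
  θ≤b^k = proj₁ (proj₂ (proj₂ window))
  2b^k≤3θ = proj₂ (proj₂ (proj₂ window))

sampling-rate : ∀ q m → ∃₂ λ a c → NonZero (a + c) × (∀ X N → N ≤ (m + m) ^ (2 + q) →
  m * a * (a + c) ^ ((2 + q) * (2 + q)) ≤ (a + c) ^ ((2 + q) * (2 + q)) * (a + c) * X + (a + c) * N * a ^ ((2 + q) * (2 + q)) →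
  m ^ (2 + q) ≤ (4 * X) ^ (3 + q))
sampling-rate q zero      = 0 , 1 , _ , λ _ _ _ _ → z≤n
sampling-rate q m@(suc _) = from-rate (rate-bracket q m (s≤s z≤n))
  where
  from-rate : ∃₂ (λ a b → 1 ≤ a × a ≤ b × threshold q m a ≤ b ^ (3 + q) × 2 * b ^ (3 + q) ≤ 3 * threshold q m a) → _
  from-rate (a , b , 1≤a , a≤b , θ≤b^k , 2b^k≤3θ) =
    a , b ∸ a , b≢0 , λ X N N≤ main → m^r≤[4X]^k (s≤s z≤n) 1≤a 2b′^k≤3θ X (3ma≤4bX θ≤b′^k X N N≤ main)
    where
    b′≡b : a + (b ∸ a) ≡ b
    b′≡b = m+[n∸m]≡n a≤b
    instance
      b≢0 : NonZero (a + (b ∸ a))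
      b≢0 = >-nonZero (≤-trans 1≤a (m≤m+n a (b ∸ a)))
    open Rate q m a (a + (b ∸ a))
    θ≤b′^k : θ ≤ (a + (b ∸ a)) ^ k
    θ≤b′^k = subst (λ z → θ ≤ z ^ k) (sym b′≡b) θ≤b^k
    2b′^k≤3θ : 2 * (a + (b ∸ a)) ^ k ≤ 3 * θ
    2b′^k≤3θ = subst (λ z → 2 * z ^ k ≤ 3 * θ) (sym b′≡b) 2b^k≤3θ

theorem3p1 : (r : ℕ) → 2 ≤ r → (n : ℕ) → (G : Graph n) →
    Σ (Graph n) λ H →
      (H ⊆G G) × (¬ ContainsK r H) × (edgeCount G ^ r ≤ (4 * edgeCount H) ^ suc r)
theorem3p1 (suc zero)      (s≤s ()) _ _
theorem3p1 r@(suc (suc q)) _        n G =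
  subgraph s , subgraph-⊆ s , subgraph-K-free r s avoids ,
  ≤-trans (rate ∣ s ∣ (length (copies r)) (length-copies r) many-kept)
          (^-monoˡ-≤ (suc r) (*-monoʳ-≤ 4 (∣s∣≤edgeCount[subgraph] s)))
  where
  open Edges G
  chosen-rate = sampling-rate q (edgeCount G)
  a = proj₁ chosen-rate
  c = proj₁ (proj₂ chosen-rate)
  rate = proj₂ (proj₂ (proj₂ chosen-rate))
  deletion = deletion-method a c (r * r) (copies r) ⦃ proj₁ (proj₂ (proj₂ chosen-rate)) ⦄ (s≤s z≤n) (copies-large r)
  s = proj₁ deletion
  avoids = proj₁ (proj₂ deletion)
  many-kept = proj₂ (proj₂ deletion)
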